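{- For every $n\ge1$, $\mathsf{D}_{\oplus}(\mathrm{MAJ}_n)\le n-\mathsf{B}(n)+1$.
   Context: $\mathrm{MAJ}_n\colon\{0,1\}^n\to\{ -1,1\}$ is defined by $\mathrm{MAJ}_n(x)=-1$ iff $\sum_{i=1}^n x_i\ge n/2$ (and $1$ otherwise). $\mathsf{B}(n)$ is the number of ones in the binary representation of $n$. A parity decision tree is a rooted binary tree whose internal nodes are labeled by parities $\bigoplus_{i\in S}x_i$ ($S\subseteq[n]$), with two outgoing edges labeled by the possible values of the parity, and leaves labeled by $-1$ or $1$; on input $x$ one follows the edges consistent with $x$ and outputs the leaf label. $\mathsf{D}_{\oplus}(f)$ is the minimal depth of a parity decision tree computing $f$. -}

module Defs where

open import Data.Nat using (ℕ; zero; suc; _+_; _≤_; _*_; _/_; _%_)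
open import Data.Bool using (Bool; true; false; _xor_; if_then_else_)
open import Data.Vec using (Vec; []; _∷_; zipWith; foldr; count)
open import Data.Sign using (Sign)
open import Data.Product using (Σ; _×_)
open import Relation.Binary.PropositionalEquality using (_≡_)
open import Relation.Nullary.Decidable using (does)
open import Data.Bool.Properties using (T?)
open import Data.Nat.Properties using (_≤?_)

-- Inputs x ∈ {0,1}^n are vectors of booleans (true = 1).
-- Outputs ±1 are signs: Sign.- is -1, Sign.+ is +1.

weight : ∀ {n} → Vec Bool n → ℕ
weight []          = 0
weight (true ∷ x)  = suc (weight x)
weight (false ∷ x) = weight x

-- MAJ_n(x) = -1 iff ∑ x_i ≥ n/2  (real division), i.e. iff 2 * ∑ x_i ≥ n
MAJ : (n : ℕ) → Vec Bool n → Sign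
MAJ n x = if does (n ≤? 2 * weight x) then Sign.- else Sign.+

-- B(n) = number of ones in the binary representation of n.
-- Fuel-based: fuel n suffices since n halves at each step.
popcountFuel : ℕ → ℕ → ℕ
popcountFuel zero     m = 0
popcountFuel (suc f)  m = m % 2 + popcountFuel f (m / 2)

B : ℕ → ℕ
B n = popcountFuel n n

-- A parity ⊕_{i ∈ S} x_i, with S ⊆ [n] given by its indicator vector.
parity : ∀ {n} → Vec Bool n → Vec Bool n → Bool
parity S x = foldr _ _xor_ false (zipWith Data.Bool._∧_ S x)
  where import Data.Bool

data PDT (n : ℕ) : Set where
  leaf : Sign → PDT n
  node : (S : Vec Bool n) → (t₀ t₁ : PDT n) → PDT n

eval : ∀ {n} → PDT n → Vec Bool n → Sign
eval (leaf b)        x = b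
eval (node S t₀ t₁)  x = if parity S x then eval t₁ x else eval t₀ x

depth : ∀ {n} → PDT n → ℕ
depth (leaf _)        = 0
depth (node _ t₀ t₁)  = suc (Data.Nat._⊔_ (depth t₀) (depth t₁))
  where import Data.Nat

Computes : ∀ {n} → PDT n → (Vec Bool n → Sign) → Set
Computes t f = ∀ x → eval t x ≡ f x

D⊕≤ : ∀ {n} → (Vec Bool n → Sign) → ℕ → Set
D⊕≤ {n} f d = Σ (PDT n) λ t → Computes t f × depth t ≤ d

-- Read the coordinates one by one into a binary counter whose position j holds at most one
-- representative coordinate, standing for 2 ^ j input bits known to equal it.  Adding a
-- coordinate propagates a carry; each collision of representatives r, r′ in position j costs
-- the query x r ⊕ x r′, after which they either merge into a carry, or contribute exactly
-- 2 ^ j ones between them and may be discarded, since [T ≤ 2 v] does not change when T grows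
-- by 2 · 2 ^ j and v by 2 ^ j.  Finally the representatives occupy distinct positions, and
-- the one in the highest position decides the majority with one more query.  With k the
-- number of representatives and unread coordinates and T the total weight they carry, the
-- depth stays within k + 1 − B T: a merge lowers k by one and keeps T, a discard lowers k by
-- two and B T by at most one (B is subadditive), and at the end k = B T.

module Submission where

open import Algebra.Bundles using (CommutativeRing)
open import Data.Bool using (Bool; true; false; _xor_; _∧_; if_then_else_)
open import Data.Bool.Properties using (∧-distribʳ-xor; xor-identityʳ; xor-∧-commutativeRing)
open import Data.Fin using (Fin; zero; suc)
open import Data.Fin.Subset using (⁅_⁆; ⊥)
open import Data.List using (List; []; _∷_; length; map; tabulate; allFin; replicate; _++_)
open import Data.List.Properties using (length-tabulate; map-tabulate)
open import Data.Maybe using (Maybe; just; nothing)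
open import Data.Nat using (ℕ; zero; suc; _+_; _*_; _^_; _∸_; _≤_; _<_; z≤n; s≤s; _/_; _%_)
open import Data.Nat.ListAction using (sum)
open import Data.Nat.DivMod using (m*n%n≡0; m*n/n≡m; [m+kn]%n≡m%n; +-distrib-/; m/n<m)
open import Data.Nat.Properties
open import Data.Nat.Tactic.RingSolver using (solve-∀)
open import Data.Product using (_,_)
open import Data.Sign using (Sign)
open import Data.Sum using (_⊎_; inj₁; inj₂)
open import Data.Vec using (Vec; []; _∷_; zipWith; lookup)
open import Relation.Binary.PropositionalEquality
open import Relation.Nullary using (yes; no)
open import Relation.Nullary.Decidable using (does; dec-true; dec-false)
open import Defs

open import Algebra.Properties.CommutativeSemigroup
  (CommutativeRing.+-commutativeSemigroup xor-∧-commutativeRing) using (interchange)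

popcountFuel-zero : ∀ f → popcountFuel f 0 ≡ 0
popcountFuel-zero zero    = refl
popcountFuel-zero (suc f) = popcountFuel-zero f

m≤1+n⇒m/2≤n : ∀ {m n} → m ≤ suc n → m / 2 ≤ n
m≤1+n⇒m/2≤n {zero}  _ = z≤n
m≤1+n⇒m/2≤n {suc m} p = ≤-pred (≤-trans (m/n<m (suc m) 2 (s≤s (s≤s z≤n))) p)

popcountFuel-stable : ∀ {f g m} → m ≤ f → m ≤ g → popcountFuel f m ≡ popcountFuel g m
popcountFuel-stable {zero}  {g}     z≤n _ = sym (popcountFuel-zero g)
popcountFuel-stable {suc f} {zero}  _ z≤n = popcountFuel-zero (suc f)
popcountFuel-stable {suc f} {suc g} {m} p q =
  cong (m % 2 +_) (popcountFuel-stable (m≤1+n⇒m/2≤n p) (m≤1+n⇒m/2≤n q))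

B-unfold : ∀ m → B m ≡ m % 2 + B (m / 2)
B-unfold zero    = refl
B-unfold (suc m) = cong (suc m % 2 +_) (popcountFuel-stable (m≤1+n⇒m/2≤n {suc m} ≤-refl) ≤-refl)

B-double : ∀ m → B (2 * m) ≡ B m
B-double m = begin
  B (2 * m)                     ≡⟨ B-unfold (2 * m) ⟩
  (2 * m) % 2 + B ((2 * m) / 2) ≡⟨ cong (λ k → k % 2 + B (k / 2)) (*-comm 2 m) ⟩
  (m * 2) % 2 + B ((m * 2) / 2) ≡⟨ cong₂ _+_ (m*n%n≡0 m 2) (cong B (m*n/n≡m m 2)) ⟩
  B m                           ∎
  where open ≡-Reasoning

B-1+double : ∀ m → B (1 + 2 * m) ≡ 1 + B m
B-1+double m = begin
  B (1 + 2 * m)                         ≡⟨ B-unfold (1 + 2 * m) ⟩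
  (1 + 2 * m) % 2 + B ((1 + 2 * m) / 2) ≡⟨ cong (λ k → (1 + k) % 2 + B ((1 + k) / 2)) (*-comm 2 m) ⟩
  (1 + m * 2) % 2 + B ((1 + m * 2) / 2) ≡⟨ cong₂ _+_ ([m+kn]%n≡m%n 1 m 2) (cong B halve) ⟩
  1 + B m                               ∎
  where
  open ≡-Reasoning
  halve : (1 + m * 2) / 2 ≡ m
  halve = trans (+-distrib-/ 1 (m * 2) (subst (λ r → 1 + r < 2) (sym (m*n%n≡0 m 2)) ≤-refl))
                (m*n/n≡m m 2)

B-2^ : ∀ k → B (2 ^ k) ≡ 1
B-2^ zero    = refl
B-2^ (suc k) = trans (B-double (2 ^ k)) (B-2^ k)

data Halving : ℕ → Set where
  even : ∀ m → Halving (2 * m)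
  odd  : ∀ m → Halving (1 + 2 * m)

halving : ∀ n → Halving n
halving zero = even 0
halving (suc n) with halving n
... | even m = odd m
... | odd  m = subst Halving (*-suc 2 m) (even (suc m))

2*m≤1+n⇒m≤n : ∀ {m n} → 2 * m ≤ suc n → m ≤ n
2*m≤1+n⇒m≤n {zero}  _ = z≤n
2*m≤1+n⇒m≤n {suc m} {n} p = ≤-trans (s≤s (m≤m+n m (m + 0))) (≤-pred (subst (_≤ suc n) (*-suc 2 m) p))

even+odd : ∀ a b → 2 * a + (1 + 2 * b) ≡ 1 + 2 * (a + b)
even+odd = solve-∀

odd+odd : ∀ a b → 1 + 2 * a + (1 + 2 * b) ≡ 2 * (1 + (a + b))
odd+odd = solve-∀

B-+-≤ : ∀ m n → B (m + n) ≤ B m + B n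
B-+-≤ m n = bounded (m + n) m n ≤-refl
  where
  open ≤-Reasoning
  -- the fuel f makes the recursion on the halves structural
  bounded : ∀ f m n → m + n ≤ f → B (m + n) ≤ B m + B n
  odd-sum : ∀ f a b → 1 + 2 * (a + b) ≤ suc f → B (1 + 2 * (a + b)) ≤ 1 + (B a + B b)

  odd-sum f a b p = begin
    B (1 + 2 * (a + b)) ≡⟨ B-1+double (a + b) ⟩
    1 + B (a + b)       ≤⟨ s≤s (bounded f a b (≤-trans (m≤m+n (a + b) _) (≤-pred p))) ⟩
    1 + (B a + B b)     ∎

  bounded zero    zero zero _ = z≤n
  bounded (suc f) m n m+n≤ with halving m | halving n
  ... | even a | even b = begin
    B (2 * a + 2 * b)     ≡⟨ cong B (sym (*-distribˡ-+ 2 a b)) ⟩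
    B (2 * (a + b))       ≡⟨ B-double (a + b) ⟩
    B (a + b)             ≤⟨ bounded f a b (2*m≤1+n⇒m≤n (subst (_≤ suc f) (sym (*-distribˡ-+ 2 a b)) m+n≤)) ⟩
    B a + B b             ≡⟨ sym (cong₂ _+_ (B-double a) (B-double b)) ⟩
    B (2 * a) + B (2 * b) ∎
  ... | even a | odd b = begin
    B (2 * a + (1 + 2 * b))   ≡⟨ cong B (even+odd a b) ⟩
    B (1 + 2 * (a + b))       ≤⟨ odd-sum f a b (subst (_≤ suc f) (even+odd a b) m+n≤) ⟩
    1 + (B a + B b)           ≡⟨ sym (+-suc (B a) (B b)) ⟩
    B a + (1 + B b)           ≡⟨ sym (cong₂ _+_ (B-double a) (B-1+double b)) ⟩
    B (2 * a) + B (1 + 2 * b) ∎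
  ... | odd a | even b = begin
    B (1 + (2 * a + 2 * b))   ≡⟨ cong B (cong suc (sym (*-distribˡ-+ 2 a b))) ⟩
    B (1 + 2 * (a + b))       ≤⟨ odd-sum f a b (subst (_≤ suc f) (cong suc (sym (*-distribˡ-+ 2 a b))) m+n≤) ⟩
    1 + (B a + B b)           ≡⟨ sym (cong₂ _+_ (B-1+double a) (B-double b)) ⟩
    B (1 + 2 * a) + B (2 * b) ∎
  ... | odd a | odd b = begin
    B (1 + 2 * a + (1 + 2 * b))   ≡⟨ cong B (odd+odd a b) ⟩
    B (2 * (1 + (a + b)))         ≡⟨ B-double (1 + (a + b)) ⟩
    B (1 + (a + b))               ≤⟨ bounded f 1 (a + b) bound ⟩
    1 + B (a + b)                 ≤⟨ s≤s (bounded f a b (≤-trans (n≤1+n _) bound)) ⟩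
    1 + (B a + B b)               ≤⟨ s≤s (+-monoʳ-≤ (B a) (n≤1+n (B b))) ⟩
    1 + (B a + (1 + B b))         ≡⟨ sym (cong₂ _+_ (B-1+double a) (B-1+double b)) ⟩
    B (1 + 2 * a) + B (1 + 2 * b) ∎
    where
    bound : 1 + (a + b) ≤ f
    bound = 2*m≤1+n⇒m≤n (subst (_≤ suc f) (odd+odd a b) m+n≤)

B-≤ : ∀ n → B n ≤ n
B-≤ zero    = z≤n
B-≤ (suc n) = ≤-trans (B-+-≤ 1 n) (s≤s (B-≤ n))

-- MAJ n x is definitionally threshold n (weight x).
threshold : ℕ → ℕ → Sign
threshold T v = if does (T ≤? 2 * v) then Sign.- else Sign.+

threshold-≤ : ∀ {T} v → T ≤ 2 * v → threshold T v ≡ Sign.-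
threshold-≤ {T} v p rewrite dec-true (T ≤? 2 * v) p = refl

threshold-> : ∀ {T} v → 2 * v < T → threshold T v ≡ Sign.+
threshold-> {T} v p rewrite dec-false (T ≤? 2 * v) (<⇒≱ p) = refl

threshold-cancel : ∀ w T v → threshold (2 * w + T) (w + v) ≡ threshold T v
threshold-cancel w T v with T ≤? 2 * v
... | yes T≤ = trans (threshold-≤ (w + v) (subst (2 * w + T ≤_) (sym (*-distribˡ-+ 2 w v)) (+-monoʳ-≤ (2 * w) T≤)))
                     (sym (threshold-≤ v T≤))
... | no  T≰ = trans (threshold-> (w + v) (subst (_< 2 * w + T) (sym (*-distribˡ-+ 2 w v)) (+-monoʳ-< (2 * w) (≰⇒> T≰))))
                     (sym (threshold-> v (≰⇒> T≰)))

parity-⊥ : ∀ {n} (x : Vec Bool n) → parity ⊥ x ≡ false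
parity-⊥ []      = refl
parity-⊥ (_ ∷ x) = parity-⊥ x

parity-⁅⁆ : ∀ {n} (i : Fin n) (x : Vec Bool n) → parity ⁅ i ⁆ x ≡ lookup x i
parity-⁅⁆ zero    (a ∷ x) = trans (cong (a xor_) (parity-⊥ x)) (xor-identityʳ a)
parity-⁅⁆ (suc i) (_ ∷ x) = parity-⁅⁆ i x

parity-xor : ∀ {n} (S T x : Vec Bool n) → parity (zipWith _xor_ S T) x ≡ parity S x xor parity T x
parity-xor []      []      []      = refl
parity-xor (s ∷ S) (t ∷ T) (a ∷ x) = begin
  ((s xor t) ∧ a) xor parity (zipWith _xor_ S T) x      ≡⟨ cong₂ _xor_ (∧-distribʳ-xor a s t) (parity-xor S T x) ⟩
  ((s ∧ a) xor (t ∧ a)) xor (parity S x xor parity T x) ≡⟨ interchange (s ∧ a) (t ∧ a) (parity S x) (parity T x) ⟩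
  ((s ∧ a) xor parity S x) xor ((t ∧ a) xor parity T x) ∎
  where open ≡-Reasoning

Computes-node : ∀ {n} (S : Vec Bool n) (t₀ t₁ : PDT n) {f₀ f₁ f} → Computes t₀ f₀ → Computes t₁ f₁ →
                (∀ x → parity S x ≡ false → f x ≡ f₀ x) → (∀ x → parity S x ≡ true → f x ≡ f₁ x) →
                Computes (node S t₀ t₁) f
Computes-node S _ _ c₀ c₁ h₀ h₁ x with parity S x in eq
... | false = trans (c₀ x) (sym (h₀ x eq))
... | true  = trans (c₁ x) (sym (h₁ x eq))

depth-node : ∀ {n} (S : Vec Bool n) (t₀ t₁ : PDT n) {b m} →
             depth t₀ + b ≤ m → depth t₁ + b ≤ m → depth (node S t₀ t₁) + b ≤ suc m
depth-node S t₀ t₁ {b} p q = s≤s (subst (_≤ _) (sym (+-distribʳ-⊔ b (depth t₀) (depth t₁))) (⊔-lub p q))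

bit : ∀ {n} → Vec Bool n → Fin n → ℕ
bit x i = if lookup x i then 1 else 0

bit≤1 : ∀ {n} (x : Vec Bool n) i → bit x i ≤ 1
bit≤1 x i with lookup x i
... | true  = s≤s z≤n
... | false = z≤n

bit-true : ∀ {n} (x : Vec Bool n) {i} → lookup x i ≡ true → bit x i ≡ 1
bit-true x = cong (if_then 1 else 0)

bit-false : ∀ {n} (x : Vec Bool n) {i} → lookup x i ≡ false → bit x i ≡ 0
bit-false x = cong (if_then 1 else 0)

bits-agree : ∀ {n} (x : Vec Bool n) i j → lookup x i xor lookup x j ≡ false → bit x i ≡ bit x j
bits-agree x i j eq with lookup x i | lookup x j
bits-agree x i j refl | true  | true  = refl
bits-agree x i j refl | false | false = refl

bits-differ : ∀ {n} (x : Vec Bool n) i j → lookup x i xor lookup x j ≡ true → bit x i + bit x j ≡ 1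
bits-differ x i j eq with lookup x i | lookup x j
bits-differ x i j refl | true  | false = refl
bits-differ x i j refl | false | true  = refl

ones : ∀ {n} → List (Fin n) → Vec Bool n → ℕ
ones is x = sum (map (bit x) is)

weight≡sum-bits : ∀ {n} (x : Vec Bool n) → weight x ≡ sum (tabulate (bit x))
weight≡sum-bits []          = refl
weight≡sum-bits (true  ∷ x) = cong suc (weight≡sum-bits x)
weight≡sum-bits (false ∷ x) = weight≡sum-bits x

weight≡ones-allFin : ∀ {n} (x : Vec Bool n) → weight x ≡ ones (allFin n) x
weight≡ones-allFin x = trans (weight≡sum-bits x) (cong sum (sym (map-tabulate (λ i → i) (bit x))))

m<n⇒1+2m<2n : ∀ {m n} → m < n → 1 + 2 * m < 2 * n
m<n⇒1+2m<2n {m} {n} m<n = begin-strict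
  1 + 2 * m   <⟨ n<1+n _ ⟩
  2 + 2 * m   ≡⟨ sym (*-suc 2 m) ⟩
  2 * (1 + m) ≤⟨ *-monoʳ-≤ 2 m<n ⟩
  2 * n       ∎
  where open ≤-Reasoning

m≤n⇒2m<1+2n : ∀ {m n} → m ≤ n → 2 * m < 1 + 2 * n
m≤n⇒2m<1+2n m≤n = s≤s (*-monoʳ-≤ 2 m≤n)

module _ {N : ℕ} where

  Counter : Set
  Counter = List (Maybe (Fin N))

  total : Counter → ℕ
  total []             = 0
  total (nothing ∷ bs) = 2 * total bs
  total (just _  ∷ bs) = 1 + 2 * total bs

  value : Counter → Vec Bool N → ℕ
  value []             x = 0
  value (nothing ∷ bs) x = 2 * value bs x
  value (just r  ∷ bs) x = bit x r + 2 * value bs x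

  size : Counter → ℕ
  size []             = 0
  size (nothing ∷ bs) = size bs
  size (just _  ∷ bs) = suc (size bs)

  shift : ℕ → Counter → Counter
  shift j bs = replicate j nothing ++ bs

  B-total : ∀ bs → B (total bs) ≡ size bs
  B-total []             = refl
  B-total (nothing ∷ bs) = trans (B-double (total bs)) (B-total bs)
  B-total (just _  ∷ bs) = trans (B-1+double (total bs)) (cong suc (B-total bs))

  value≤total : ∀ bs x → value bs x ≤ total bs
  value≤total []             x = z≤n
  value≤total (nothing ∷ bs) x = *-monoʳ-≤ 2 (value≤total bs x)
  value≤total (just r  ∷ bs) x = +-mono-≤ (bit≤1 x r) (*-monoʳ-≤ 2 (value≤total bs x))

  total-shift : ∀ j bs → total (shift j bs) ≡ 2 ^ j * total bs
  total-shift zero    bs = sym (*-identityˡ (total bs))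
  total-shift (suc j) bs = trans (cong (2 *_) (total-shift j bs)) (sym (*-assoc 2 (2 ^ j) (total bs)))

  value-shift : ∀ j bs x → value (shift j bs) x ≡ 2 ^ j * value bs x
  value-shift zero    bs x = sym (*-identityˡ (value bs x))
  value-shift (suc j) bs x = trans (cong (2 *_) (value-shift j bs x)) (sym (*-assoc 2 (2 ^ j) (value bs x)))

  size-shift : ∀ j bs → size (shift j bs) ≡ size bs
  size-shift zero    bs = refl
  size-shift (suc j) bs = size-shift j bs

  -- The coordinate in the highest occupied position outweighs all the others together.
  record Leader (bs : Counter) : Set where
    field
      index : Fin N
      above : ∀ x → lookup x index ≡ true  → total bs < 2 * value bs x
      below : ∀ x → lookup x index ≡ false → 2 * value bs x < total bs

  leader : ∀ bs → total bs ≡ 0 ⊎ Leader bs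
  leader [] = inj₁ refl
  leader (b ∷ bs) with leader bs
  leader (nothing ∷ bs) | inj₁ empty = inj₁ (cong (2 *_) empty)
  leader (just r  ∷ bs) | inj₁ empty = inj₂ record
    { index = r
    ; above = λ x xr → m<n⇒1+2m<2n (subst (_< bit x r + 2 * value bs x) (sym empty)
                                           (≤-trans (≤-reflexive (sym (bit-true x xr))) (m≤m+n _ _)))
    ; below = λ x xr → m≤n⇒2m<1+2n (subst (_≤ total bs) (sym (zero-value x xr)) z≤n)
    }
    where
    zero-value : ∀ x → lookup x r ≡ false → bit x r + 2 * value bs x ≡ 0
    zero-value x xr rewrite bit-false x xr | n≤0⇒n≡0 (subst (value bs x ≤_) empty (value≤total bs x)) = refl
  leader (nothing ∷ bs) | inj₂ ℓ = inj₂ record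
    { index = index
    ; above = λ x xr → *-monoʳ-< 2 (above x xr)
    ; below = λ x xr → *-monoʳ-< 2 (below x xr)
    }
    where open Leader ℓ
  leader (just r  ∷ bs) | inj₂ ℓ = inj₂ record
    { index = index
    ; above = λ x xr → m<n⇒1+2m<2n (≤-trans (above x xr) (m≤n+m _ (bit x r)))
    ; below = λ x xr → m≤n⇒2m<1+2n (≤-trans (+-monoˡ-≤ _ (bit≤1 x r)) (below x xr))
    }
    where open Leader ℓ

  record Solvable (k T : ℕ) (v : Vec Bool N → ℕ) : Set where
    constructor solution
    field
      tree     : PDT N
      computes : Computes tree (λ x → threshold T (v x))
      cost     : depth tree + B T ≤ k + 1

  Solvable-cong : ∀ {k k′ T T′ v v′} → k ≡ k′ → T ≡ T′ → (∀ x → v x ≡ v′ x) →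
                  Solvable k T v → Solvable k′ T′ v′
  Solvable-cong {T = T} refl refl v≗v′ (solution t computes cost) =
    solution t (λ x → trans (computes x) (cong (threshold T) (v≗v′ x))) cost

  collide : ∀ j r r′ {k T v} →
            Solvable (suc k) (2 ^ suc j + T) (λ x → 2 ^ suc j * bit x r + v x) → Solvable k T v →
            Solvable (suc (suc k)) (2 ^ suc j + T) (λ x → 2 ^ j * bit x r + (2 ^ j * bit x r′ + v x))
  collide j r r′ {k} {T} {v} (solution t₀ computes₀ cost₀) (solution t₁ computes₁ cost₁) =
    solution (node S t₀ t₁) (Computes-node S t₀ t₁ computes₀ computes₁ merged dropped)
             (depth-node S t₀ t₁ cost₀ cost₁′)
    where
    S : Vec Bool N
    S = zipWith _xor_ ⁅ r ⁆ ⁅ r′ ⁆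
    w : ℕ
    w = 2 ^ j

    query : ∀ x → parity S x ≡ lookup x r xor lookup x r′
    query x = trans (parity-xor ⁅ r ⁆ ⁅ r′ ⁆ x) (cong₂ _xor_ (parity-⁅⁆ r x) (parity-⁅⁆ r′ x))

    merged : ∀ x → parity S x ≡ false →
             threshold (2 * w + T) (w * bit x r + (w * bit x r′ + v x)) ≡ threshold (2 * w + T) (2 * w * bit x r + v x)
    merged x p = cong (threshold (2 * w + T)) (begin
      w * bit x r + (w * bit x r′ + v x) ≡⟨ cong (λ b → w * bit x r + (w * b + v x)) (sym (bits-agree x r r′ (trans (sym (query x)) p))) ⟩
      w * bit x r + (w * bit x r + v x)  ≡⟨ double w (bit x r) (v x) ⟩
      2 * w * bit x r + v x              ∎)
      where
      open ≡-Reasoning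
      double : ∀ w b v → w * b + (w * b + v) ≡ 2 * w * b + v
      double = solve-∀

    dropped : ∀ x → parity S x ≡ true → threshold (2 * w + T) (w * bit x r + (w * bit x r′ + v x)) ≡ threshold T (v x)
    dropped x p = trans (cong (threshold (2 * w + T)) (begin
      w * bit x r + (w * bit x r′ + v x) ≡⟨ factor w (bit x r) (bit x r′) (v x) ⟩
      w * (bit x r + bit x r′) + v x     ≡⟨ cong (λ b → w * b + v x) (bits-differ x r r′ (trans (sym (query x)) p)) ⟩
      w * 1 + v x                        ≡⟨ cong (_+ v x) (*-identityʳ w) ⟩
      w + v x                            ∎)) (threshold-cancel w T (v x))
      where
      open ≡-Reasoning
      factor : ∀ w b b′ v → w * b + (w * b′ + v) ≡ w * (b + b′) + v
      factor = solve-∀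

    cost₁′ : depth t₁ + B (2 * w + T) ≤ suc k + 1
    cost₁′ = begin
      depth t₁ + B (2 * w + T)        ≤⟨ +-monoʳ-≤ (depth t₁) (B-+-≤ (2 * w) T) ⟩
      depth t₁ + (B (2 * w) + B T)    ≡⟨ cong (λ b → depth t₁ + (b + B T)) (B-2^ (suc j)) ⟩
      depth t₁ + suc (B T)            ≡⟨ +-suc (depth t₁) (B T) ⟩
      suc (depth t₁ + B T)            ≤⟨ s≤s cost₁ ⟩
      suc k + 1                       ∎
      where open ≤-Reasoning

  counter-solvable : ∀ bs → Solvable (size bs) (total bs) (value bs)
  counter-solvable bs with leader bs
  ... | inj₁ empty = solution (leaf Sign.-) computes (≤-trans (≤-reflexive (B-total bs)) (m≤m+n (size bs) 1))
    where
    computes : Computes (leaf Sign.-) (λ x → threshold (total bs) (value bs x))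
    computes x = sym (threshold-≤ (value bs x) (subst (_≤ 2 * value bs x) (sym empty) z≤n))
  ... | inj₂ ℓ = solution (node ⁅ index ⁆ (leaf Sign.+) (leaf Sign.-)) computes cost
    where
    open Leader ℓ
    computes : Computes (node ⁅ index ⁆ (leaf Sign.+) (leaf Sign.-)) (λ x → threshold (total bs) (value bs x))
    computes = Computes-node ⁅ index ⁆ (leaf Sign.+) (leaf Sign.-) (λ _ → refl) (λ _ → refl)
      (λ x p → threshold-> (value bs x) (below x (trans (sym (parity-⁅⁆ index x)) p)))
      (λ x p → threshold-≤ (value bs x) (<⇒≤ (above x (trans (sym (parity-⁅⁆ index x)) p))))
    cost : 1 + B (total bs) ≤ size bs + 1
    cost = ≤-reflexive (trans (cong suc (B-total bs)) (+-comm 1 (size bs)))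

  module _ {k₀ T₀ : ℕ} {v₀ : Vec Bool N → ℕ}
           (solve-rest : ∀ bs → Solvable (size bs + k₀) (total bs + T₀) (λ x → value bs x + v₀ x)) where

    solve-rest-shifted : ∀ j bs → Solvable (size bs + k₀) (2 ^ j * total bs + T₀) (λ x → 2 ^ j * value bs x + v₀ x)
    solve-rest-shifted j bs =
      Solvable-cong (cong (_+ k₀) (size-shift j bs)) (cong (_+ T₀) (total-shift j bs))
                    (λ x → cong (_+ v₀ x) (value-shift j bs x)) (solve-rest (shift j bs))

    -- insert j r bs adds r in position j to the counter shift j bs, whose lower positions are empty.
    insert : ∀ j r bs → Solvable (suc (size bs) + k₀) (2 ^ j * (1 + total bs) + T₀)
                                 (λ x → 2 ^ j * (bit x r + value bs x) + v₀ x)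
    insert j r []             = solve-rest-shifted j (just r ∷ [])
    insert j r (nothing ∷ bs) = solve-rest-shifted j (just r ∷ bs)
    insert j r (just r′ ∷ bs) =
      Solvable-cong refl (split-total (2 ^ j) (total bs) T₀)
                    (λ x → split-value (2 ^ j) (bit x r) (bit x r′) (value bs x) (v₀ x))
                    (collide j r r′ carried (solve-rest-shifted (suc j) bs))
      where
      carry-total : ∀ W T R → W * (1 + T) + R ≡ W + (W * T + R)
      carry-total = solve-∀
      carry-value : ∀ W b V R → W * (b + V) + R ≡ W * b + (W * V + R)
      carry-value = solve-∀
      split-total : ∀ w T R → 2 * w + (2 * w * T + R) ≡ w * (1 + (1 + 2 * T)) + R
      split-total = solve-∀
      split-value : ∀ w b b′ V R → w * b + (w * b′ + (2 * w * V + R)) ≡ w * (b + (b′ + 2 * V)) + R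
      split-value = solve-∀

      carried : Solvable (suc (size bs + k₀)) (2 ^ suc j + (2 ^ suc j * total bs + T₀))
                         (λ x → 2 ^ suc j * bit x r + (2 ^ suc j * value bs x + v₀ x))
      carried = Solvable-cong refl (carry-total (2 ^ suc j) (total bs) T₀)
                              (λ x → carry-value (2 ^ suc j) (bit x r) (value bs x) (v₀ x))
                              (insert (suc j) r bs)

  solve : ∀ is bs → Solvable (size bs + length is) (total bs + length is) (λ x → value bs x + ones is x)
  solve []       bs = Solvable-cong (sym (+-identityʳ _)) (sym (+-identityʳ _)) (λ _ → sym (+-identityʳ _))
                                    (counter-solvable bs)
  solve (i ∷ is) bs = Solvable-cong (sym (+-suc (size bs) (length is)))
                                    (trans (cong (_+ length is) (*-identityˡ _)) (sym (+-suc (total bs) (length is))))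
                                    (λ x → rearrange (bit x i) (value bs x) (ones is x))
                                    (insert (solve is) 0 i bs)
    where
    rearrange : ∀ b V R → 1 * (b + V) + R ≡ V + (b + R)
    rearrange = solve-∀

  majority-solvable : Solvable N N weight
  majority-solvable = Solvable-cong (length-tabulate (λ i → i)) (length-tabulate (λ i → i))
                                    (λ x → sym (weight≡ones-allFin x)) (solve (allFin N) [])

majority-depth : ∀ n → D⊕≤ (MAJ n) (n ∸ B n + 1)
majority-depth n = tree , computes , (begin
  depth tree    ≤⟨ m+n≤o⇒m≤o∸n (depth tree) cost ⟩
  n + 1 ∸ B n   ≡⟨ +-∸-comm 1 (B-≤ n) ⟩
  n ∸ B n + 1   ∎)
  where
  open Solvable (majority-solvable {n})
  open ≤-Reasoning

lemma7 : (n : ℕ) → D⊕≤ (MAJ (suc n)) (suc n ∸ B (suc n) + 1)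
lemma7 n = majority-depth (suc n)
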